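{- For $m,n\geq 0$, the noncrossing matching complex $\Gamma(m,n)$ is vertex decomposable.
   Context: Let $X=\{x_1,\dots,x_m\}$, $Y=\{y_1,\dots,y_n\}$, $\mathcal E(X,Y)=\{\{x,y\}:x\in X,y\in Y\}$. The noncrossing matching complex $\Gamma(m,n)$ is the simplicial complex on vertex set $X\uplus Y\uplus\mathcal E(X,Y)$ (elements of $X\uplus Y$ are called loops, elements of $\mathcal E(X,Y)$ edges) whose faces are the sets $\sigma$ such that (i) each letter $x_s$ or $y_t$ occurs at most once among the loops and edges of $\sigma$, and (ii) if $\{x_{s_1},y_{t_1}\},\{x_{s_2},y_{t_2}\}\in\sigma$ with $s_1<s_2$ then $t_1<t_2$. For a face $F$ of a complex $\Delta$, $\mathsf{link}_\Delta(F)=\{G\in\Delta:F\cap G=\emptyset, F\cup G\in\Delta\}$ and $\mathsf{del}_\Delta(F)=\{G\in\Delta:F\not\subseteq G\}$. A complex $\Delta$ is vertex decomposable if it is a simplex, or $\Delta=\{\emptyset\}$, or there is a vertex $v$ such that $\mathsf{link}_\Delta(v)$ and $\mathsf{del}_\Delta(v)$ are vertex decomposable and have no common facets. -}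

module Defs where

open import Data.Nat using (ℕ; _+_; _*_)
open import Data.Fin using (Fin; _<_; splitAt; remQuot)
open import Data.Fin.Subset using (Subset; _∈_; _∉_; _⊆_; _∪_; _∩_; ⁅_⁆; ⊥)
open import Data.Product using (Σ; ∃; _×_; _,_)
open import Data.Sum using (_⊎_; inj₁; inj₂)
open import Data.Empty renaming (⊥ to Void)
open import Relation.Nullary using (¬_)
open import Relation.Binary.PropositionalEquality using (_≡_; _≢_)

Complex : ℕ → Set₁
Complex N = Subset N → Set

module _ {N : ℕ} where

  link : Complex N → Subset N → Complex N
  link Δ F G = Δ G × (F ∩ G ≡ ⊥) × Δ (F ∪ G)

  del : Complex N → Subset N → Complex N
  del Δ F G = Δ G × ¬ (F ⊆ G)

  IsFacet : Complex N → Subset N → Set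
  IsFacet Δ F = Δ F × (∀ G → Δ G → F ⊆ G → G ≡ F)

  IsSimplex : Complex N → Set
  IsSimplex Δ = Σ (Subset N) λ S → ∀ F → (Δ F → F ⊆ S) × (F ⊆ S → Δ F)

  IsEmptyFaceOnly : Complex N → Set
  IsEmptyFaceOnly Δ = ∀ F → (Δ F → F ≡ ⊥) × (F ≡ ⊥ → Δ F)

  data VertexDecomposable : Complex N → Set₁ where
    simplex  : ∀ {Δ} → IsSimplex Δ → VertexDecomposable Δ
    emptyCx  : ∀ {Δ} → IsEmptyFaceOnly Δ → VertexDecomposable Δ
    shedding : ∀ {Δ} (v : Fin N) → Δ ⁅ v ⁆
             → VertexDecomposable (link Δ ⁅ v ⁆)
             → VertexDecomposable (del Δ ⁅ v ⁆)
             → (¬ Σ (Subset N) λ F → IsFacet (link Δ ⁅ v ⁆) F × IsFacet (del Δ ⁅ v ⁆) F)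
             → VertexDecomposable Δ

data Vtx (m n : ℕ) : Set where
  loopX : Fin m → Vtx m n
  loopY : Fin n → Vtx m n
  edge  : Fin m → Fin n → Vtx m n

-- number of vertices m + n + m n ; the vertex set is identified with
-- Fin (m + n + m * n) via the bijection `decode` below
NV : ℕ → ℕ → ℕ
NV m n = (m + n) + m * n

decode : ∀ m n → Fin (NV m n) → Vtx m n
decode m n i with splitAt (m + n) i
... | inj₂ k = let (s , t) = remQuot n k in edge s t
... | inj₁ j with splitAt m j
...   | inj₁ s = loopX s
...   | inj₂ t = loopY t

HasX : ∀ {m n} → Fin m → Vtx m n → Set
HasX s (loopX s') = s ≡ s'
HasX s (loopY _)  = Void
HasX s (edge s' _) = s ≡ s'

HasY : ∀ {m n} → Fin n → Vtx m n → Set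
HasY t (loopX _)  = Void
HasY t (loopY t') = t ≡ t'
HasY t (edge _ t') = t ≡ t'

ShareLetter : ∀ {m n} → Vtx m n → Vtx m n → Set
ShareLetter {m} {n} u w =
  (Σ (Fin m) λ s → HasX s u × HasX s w) ⊎ (Σ (Fin n) λ t → HasY t u × HasY t w)

Γ : (m n : ℕ) → Complex (NV m n)
Γ m n σ =
  (∀ u w → u ∈ σ → w ∈ σ → u ≢ w → ¬ ShareLetter (decode m n u) (decode m n w))
  ×
  (∀ u w → u ∈ σ → w ∈ σ → ∀ s₁ t₁ s₂ t₂ →
     decode m n u ≡ edge s₁ t₁ → decode m n w ≡ edge s₂ t₂ → s₁ < s₂ → t₁ < t₂)

-- Γ(m,n) is the flag complex of the compatibility graph on its vertices: two vertices are
-- adjacent when they share no letter and, if both are edges, do not cross.  In a flag complex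
-- a vertex v is a shedding vertex as soon as some w is not adjacent to v but adjacent to all
-- neighbours of v: a facet of the deletion of v then contains w, so it is not a facet of the
-- link.  By induction on W, the subcomplex induced on any vertex set W that contains, with each
-- edge {x_s, y_t}, also the loop x_s, is vertex decomposable.  If W contains no edge, its loops
-- are pairwise compatible and the subcomplex is a simplex.  Otherwise an edge {x_s, y_t} of W
-- is dominated by the loop x_s in the above sense, and both the deletion and the neighbourhood
-- of the edge again have the closure property.
module Submission where

open import Defs
open import Data.Nat.Base using (ℕ; _+_; _*_)
open import Data.Fin.Base using (Fin; _<_; join; combine; splitAt)
open import Data.Fin.Properties
  using (_≟_; _<?_; <-irrefl; any?; splitAt-join; remQuot-combine; combine-remQuot;
         splitAt⁻¹-↑ˡ; splitAt⁻¹-↑ʳ)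
open import Data.Fin.Subset
  using (Subset; _∈_; _∉_; _⊆_; _⊂_; _∪_; _∩_; _─_; _-_; ⁅_⁆; ⊥; ⊤; inside; outside)
open import Data.Fin.Subset.Properties
  using (_∈?_; Empty-unique; ∉⊥; ∈⊤; x∈⁅x⁆; x∈⁅y⁆⇒x≡y; x∈p∩q⁺; x∈p∩q⁻; x∈p∪q⁺; x∈p∪q⁻;
         x∈p∧x≢y⇒x∈p-y; p─q⊆p; x∈p⇒p-x⊂p; ⊆-⊂-trans)
open import Data.Fin.Subset.Induction using (⊂-wellFounded; Acc; acc)
open import Data.Vec.Base using (_∷_; tabulate; here; there)
open import Data.Vec.Properties using (lookup∘tabulate; []=⇒lookup; lookup⇒[]=)
open import Data.Product using (∃₂; _×_; _,_; proj₁; proj₂; uncurry)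
open import Data.Sum using (_⊎_; inj₁; inj₂)
open import Data.Empty using (⊥-elim)
open import Function using (_∘_)
open import Relation.Nullary using (¬_; Dec; yes; no; does)
open import Relation.Nullary.Decidable using (dec-true; _×-dec_; _⊎-dec_; _→-dec_; ¬?)
open import Relation.Unary using (Pred; Decidable; _≐_)
open import Relation.Unary.Properties using (≐-sym)
open import Relation.Binary.PropositionalEquality
  using (_≡_; _≢_; refl; sym; trans; subst; subst₂; cong)

module _ {N : ℕ} where

  link-resp-≐ : ∀ {Δ Δ′ : Complex N} F → Δ ≐ Δ′ → link Δ F ≐ link Δ′ F
  link-resp-≐ F (Δ⊆Δ′ , Δ′⊆Δ) =
    (λ (G∈Δ , disjoint , F∪G∈Δ) → Δ⊆Δ′ G∈Δ , disjoint , Δ⊆Δ′ F∪G∈Δ) ,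
    (λ (G∈Δ′ , disjoint , F∪G∈Δ′) → Δ′⊆Δ G∈Δ′ , disjoint , Δ′⊆Δ F∪G∈Δ′)

  del-resp-≐ : ∀ {Δ Δ′ : Complex N} F → Δ ≐ Δ′ → del Δ F ≐ del Δ′ F
  del-resp-≐ F (Δ⊆Δ′ , Δ′⊆Δ) =
    (λ (G∈Δ , F⊈G) → Δ⊆Δ′ G∈Δ , F⊈G) , (λ (G∈Δ′ , F⊈G) → Δ′⊆Δ G∈Δ′ , F⊈G)

  IsFacet-resp-≐ : ∀ {Δ Δ′ : Complex N} {F} → Δ ≐ Δ′ → IsFacet Δ F → IsFacet Δ′ F
  IsFacet-resp-≐ (Δ⊆Δ′ , Δ′⊆Δ) (F∈Δ , maximal) = Δ⊆Δ′ F∈Δ , λ G G∈Δ′ → maximal G (Δ′⊆Δ G∈Δ′)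

  VertexDecomposable-resp-≐ : ∀ {Δ Δ′ : Complex N} → Δ ≐ Δ′ →
                              VertexDecomposable Δ → VertexDecomposable Δ′
  VertexDecomposable-resp-≐ (Δ⊆Δ′ , Δ′⊆Δ) (simplex (S , faces)) =
    simplex (S , λ F → proj₁ (faces F) ∘ Δ′⊆Δ , Δ⊆Δ′ ∘ proj₂ (faces F))
  VertexDecomposable-resp-≐ (Δ⊆Δ′ , Δ′⊆Δ) (emptyCx faces) =
    emptyCx λ F → proj₁ (faces F) ∘ Δ′⊆Δ , Δ⊆Δ′ ∘ proj₂ (faces F)
  VertexDecomposable-resp-≐ Δ≐Δ′@(Δ⊆Δ′ , _) (shedding v v∈Δ linkVD delVD noCommonFacet) =
    shedding v (Δ⊆Δ′ v∈Δ)
      (VertexDecomposable-resp-≐ link≐ linkVD)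
      (VertexDecomposable-resp-≐ del≐ delVD)
      λ (F , inLink , inDel) →
        noCommonFacet (F , IsFacet-resp-≐ (≐-sym link≐) inLink , IsFacet-resp-≐ (≐-sym del≐) inDel)
    where
    link≐ = link-resp-≐ ⁅ v ⁆ Δ≐Δ′
    del≐  = del-resp-≐ ⁅ v ⁆ Δ≐Δ′

x∈p─q⇒x∉q : ∀ {n} (p q : Subset n) {x} → x ∈ p ─ q → x ∉ q
x∈p─q⇒x∉q (inside ∷ p) (outside ∷ q) here      ()
x∈p─q⇒x∉q (_      ∷ p) (_       ∷ q) (there x∈) (there x∈q) = x∈p─q⇒x∉q p q x∈ x∈q

module _ {N : ℕ} where

  select : ∀ {ℓ} {P : Pred (Fin N) ℓ} → Decidable P → Subset N
  select P? = tabulate (λ x → does (P? x))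

  ∈-select⁻ : ∀ {ℓ} {P : Pred (Fin N) ℓ} (P? : Decidable P) {x} → x ∈ select P? → P x
  ∈-select⁻ P? {x} x∈ with P? x | trans (sym (lookup∘tabulate (does ∘ P?) x)) ([]=⇒lookup x∈)
  ... | yes px | _ = px
  ... | no _   | ()

  ∈-select⁺ : ∀ {ℓ} {P : Pred (Fin N) ℓ} (P? : Decidable P) {x} → P x → x ∈ select P?
  ∈-select⁺ P? {x} px = lookup⇒[]= x _ (trans (lookup∘tabulate (does ∘ P?) x) (dec-true (P? x) px))

  x∉p-x : ∀ (p : Subset N) {x} → x ∉ p - x
  x∉p-x p {x} x∈ = x∈p─q⇒x∉q p ⁅ x ⁆ x∈ (x∈⁅x⁆ x)

  ∈-⁅⁆∪⁻ : ∀ {w x} (p : Subset N) → x ∈ ⁅ w ⁆ ∪ p → x ≡ w ⊎ x ∈ p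
  ∈-⁅⁆∪⁻ {w} p x∈ with x∈p∪q⁻ ⁅ w ⁆ p x∈
  ... | inj₁ x∈⁅w⁆ = inj₁ (x∈⁅y⁆⇒x≡y w x∈⁅w⁆)
  ... | inj₂ x∈p   = inj₂ x∈p

  ⁅⁆∪-⊆ : ∀ {w} {p q : Subset N} → w ∈ q → p ⊆ q → ⁅ w ⁆ ∪ p ⊆ q
  ⁅⁆∪-⊆ {p = p} w∈q p⊆q x∈ with ∈-⁅⁆∪⁻ p x∈
  ... | inj₁ refl = w∈q
  ... | inj₂ x∈p  = p⊆q x∈p

  ⁅⁆∩-disjoint : ∀ {w} {p : Subset N} → w ∉ p → ⁅ w ⁆ ∩ p ≡ ⊥
  ⁅⁆∩-disjoint {w} {p} w∉p = Empty-unique λ (x , x∈) →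
    let x∈⁅w⁆ , x∈p = x∈p∩q⁻ ⁅ w ⁆ p x∈ in w∉p (subst (_∈ p) (x∈⁅y⁆⇒x≡y w x∈⁅w⁆) x∈p)

module FlagComplex {N : ℕ} {_~_ : Fin N → Fin N → Set}
                   (~-sym : ∀ {u w} → u ~ w → w ~ u)
                   (_~?_ : ∀ u w → Dec (u ~ w)) where

  IsClique : Subset N → Set
  IsClique F = ∀ {u w} → u ∈ F → w ∈ F → u ≢ w → u ~ w

  Flag : Subset N → Complex N
  Flag W F = F ⊆ W × IsClique F

  IsNeighbourIn : Subset N → Fin N → Fin N → Set
  IsNeighbourIn W v u = u ∈ W × u ≢ v × v ~ u

  isNeighbourIn? : ∀ W v → Decidable (IsNeighbourIn W v)
  isNeighbourIn? W v u = (u ∈? W) ×-dec ¬? (u ≟ v) ×-dec (v ~? u)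

  neighbours : Subset N → Fin N → Subset N
  neighbours W v = select (isNeighbourIn? W v)

  ∈-neighbours⁻ : ∀ {W v u} → u ∈ neighbours W v → IsNeighbourIn W v u
  ∈-neighbours⁻ {W} {v} = ∈-select⁻ (isNeighbourIn? W v)

  ∈-neighbours⁺ : ∀ {W v u} → IsNeighbourIn W v u → u ∈ neighbours W v
  ∈-neighbours⁺ {W} {v} = ∈-select⁺ (isNeighbourIn? W v)

  neighbour-≢ : ∀ {W v u} → u ∈ neighbours W v → u ≢ v
  neighbour-≢ = proj₁ ∘ proj₂ ∘ ∈-neighbours⁻

  neighbour-adjacent : ∀ {W v u} → u ∈ neighbours W v → v ~ u
  neighbour-adjacent = proj₂ ∘ proj₂ ∘ ∈-neighbours⁻

  neighbours⊆ : ∀ {W v} → neighbours W v ⊆ W - v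
  neighbours⊆ u∈ = let u∈W , u≢v , _ = ∈-neighbours⁻ u∈ in x∈p∧x≢y⇒x∈p-y u∈W u≢v

  ⁅⁆-isClique : ∀ v → IsClique ⁅ v ⁆
  ⁅⁆-isClique v u∈ w∈ u≢w = ⊥-elim (u≢w (trans (x∈⁅y⁆⇒x≡y v u∈) (sym (x∈⁅y⁆⇒x≡y v w∈))))

  ⁅⁆∪-isClique : ∀ {w F} → (∀ {u} → u ∈ F → w ~ u) → IsClique F → IsClique (⁅ w ⁆ ∪ F)
  ⁅⁆∪-isClique {F = F} w~F F-clique u∈ u′∈ u≢u′ with ∈-⁅⁆∪⁻ F u∈ | ∈-⁅⁆∪⁻ F u′∈
  ... | inj₁ refl | inj₁ refl = ⊥-elim (u≢u′ refl)
  ... | inj₁ refl | inj₂ u′∈F = w~F u′∈F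
  ... | inj₂ u∈F  | inj₁ refl = ~-sym (w~F u∈F)
  ... | inj₂ u∈F  | inj₂ u′∈F = F-clique u∈F u′∈F u≢u′

  isClique⇒isSimplex : ∀ {W} → IsClique W → IsSimplex (Flag W)
  isClique⇒isSimplex {W} W-clique =
    W , λ F → proj₁ , λ F⊆W → F⊆W , λ u∈ w∈ → W-clique (F⊆W u∈) (F⊆W w∈)

  link-Flag : ∀ {W v} → v ∈ W → link (Flag W) ⁅ v ⁆ ≐ Flag (neighbours W v)
  link-Flag {W} {v} v∈W = to , from
    where
    to : ∀ {G} → link (Flag W) ⁅ v ⁆ G → Flag (neighbours W v) G
    to {G} ((G⊆W , G-clique) , disjoint , (_ , v∪G-clique)) = G⊆neighbours , G-clique
      where
      ≢v : ∀ {x} → x ∈ G → x ≢ v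
      ≢v x∈G refl = ∉⊥ (subst (v ∈_) disjoint (x∈p∩q⁺ (x∈⁅x⁆ v , x∈G)))
      G⊆neighbours : G ⊆ neighbours W v
      G⊆neighbours x∈G =
        ∈-neighbours⁺ (G⊆W x∈G , ≢v x∈G ,
          v∪G-clique (x∈p∪q⁺ (inj₁ (x∈⁅x⁆ v))) (x∈p∪q⁺ (inj₂ x∈G)) (≢v x∈G ∘ sym))
    from : ∀ {G} → Flag (neighbours W v) G → link (Flag W) ⁅ v ⁆ G
    from {G} (G⊆neighbours , G-clique) =
      (G⊆W , G-clique) ,
      ⁅⁆∩-disjoint (λ v∈G → neighbour-≢ (G⊆neighbours v∈G) refl) ,
      ⁅⁆∪-⊆ v∈W G⊆W , ⁅⁆∪-isClique (neighbour-adjacent ∘ G⊆neighbours) G-clique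
      where
      G⊆W : G ⊆ W
      G⊆W = proj₁ ∘ ∈-neighbours⁻ ∘ G⊆neighbours

  del-Flag : ∀ {W v} → del (Flag W) ⁅ v ⁆ ≐ Flag (W - v)
  del-Flag {W} {v} = to , from
    where
    to : ∀ {G} → del (Flag W) ⁅ v ⁆ G → Flag (W - v) G
    to {G} ((G⊆W , G-clique) , v∉G) = G⊆W-v , G-clique
      where
      G⊆W-v : G ⊆ W - v
      G⊆W-v x∈G = x∈p∧x≢y⇒x∈p-y (G⊆W x∈G)
        λ { refl → v∉G λ y∈⁅v⁆ → subst (_∈ G) (sym (x∈⁅y⁆⇒x≡y v y∈⁅v⁆)) x∈G }
    from : ∀ {G} → Flag (W - v) G → del (Flag W) ⁅ v ⁆ G
    from (G⊆W-v , G-clique) =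
      (p─q⊆p W ⁅ v ⁆ ∘ G⊆W-v , G-clique) , λ ⁅v⁆⊆G → x∉p-x W (G⊆W-v (⁅v⁆⊆G (x∈⁅x⁆ v)))

  record Dominates (W : Subset N) (w v : Fin N) : Set where
    field
      v∈W       : v ∈ W
      w∈W       : w ∈ W
      w≢v       : w ≢ v
      v≁w       : ¬ v ~ w
      adjacent  : ∀ {u} → u ∈ neighbours W v → w ~ u

  dominates⇒noCommonFacet : ∀ {W w v F} → Dominates W w v →
    ¬ (IsFacet (Flag (neighbours W v)) F × IsFacet (Flag (W - v)) F)
  dominates⇒noCommonFacet {W} {w} {v} {F} dom (((F⊆neighbours , _) , _) , ((_ , F-clique) , maximal)) =
    v≁w (neighbour-adjacent (F⊆neighbours w∈F))
    where
    open Dominates dom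
    w∪F∈Flag : Flag (W - v) (⁅ w ⁆ ∪ F)
    w∪F∈Flag = ⁅⁆∪-⊆ (x∈p∧x≢y⇒x∈p-y w∈W w≢v) (neighbours⊆ ∘ F⊆neighbours)
             , ⁅⁆∪-isClique (adjacent ∘ F⊆neighbours) F-clique
    w∈F : w ∈ F
    w∈F = subst (w ∈_) (maximal _ w∪F∈Flag (x∈p∪q⁺ ∘ inj₂)) (x∈p∪q⁺ (inj₁ (x∈⁅x⁆ w)))

  CliqueOrShedding : (Subset N → Set) → Subset N → Set
  CliqueOrShedding Closed W =
    IsClique W ⊎ ∃₂ λ w v → Dominates W w v × Closed (W - v) × Closed (neighbours W v)

  flag-vertexDecomposable : {Closed : Subset N → Set} →
    (∀ {W} → Closed W → CliqueOrShedding Closed W) →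
    ∀ {W} → Closed W → VertexDecomposable (Flag W)
  flag-vertexDecomposable {Closed} split {W} = go W (⊂-wellFounded W)
    where
    go : ∀ W → Acc _⊂_ W → Closed W → VertexDecomposable (Flag W)
    go W (acc rec) closed with split closed
    ... | inj₁ W-clique = simplex (isClique⇒isSimplex W-clique)
    ... | inj₂ (w , v , dom , closed-del , closed-link) =
      shedding v (⁅v⁆⊆W , ⁅⁆-isClique v)
        (VertexDecomposable-resp-≐ (≐-sym (link-Flag v∈W)) (go _ (rec link⊂W) closed-link))
        (VertexDecomposable-resp-≐ (≐-sym del-Flag) (go _ (rec del⊂W) closed-del))
        λ (F , inLink , inDel) → dominates⇒noCommonFacet dom
          (IsFacet-resp-≐ (link-Flag v∈W) inLink , IsFacet-resp-≐ del-Flag inDel)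
      where
      open Dominates dom using (v∈W)
      ⁅v⁆⊆W : ⁅ v ⁆ ⊆ W
      ⁅v⁆⊆W x∈ = subst (_∈ W) (sym (x∈⁅y⁆⇒x≡y v x∈)) v∈W
      del⊂W : W - v ⊂ W
      del⊂W = x∈p⇒p-x⊂p v∈W
      link⊂W : neighbours W v ⊂ W
      link⊂W = ⊆-⊂-trans neighbours⊆ del⊂W

module NoncrossingMatching (m n : ℕ) where

  vtx : Fin (NV m n) → Vtx m n
  vtx = decode m n

  encode : Vtx m n → Fin (NV m n)
  encode (loopX s)  = join (m + n) (m * n) (inj₁ (join m n (inj₁ s)))
  encode (loopY t)  = join (m + n) (m * n) (inj₁ (join m n (inj₂ t)))
  encode (edge s t) = join (m + n) (m * n) (inj₂ (combine s t))

  encode-decode : ∀ i → encode (vtx i) ≡ i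
  encode-decode i with splitAt (m + n) i in eq
  ... | inj₂ k = trans (cong (join (m + n) (m * n) ∘ inj₂) (combine-remQuot {m} n k)) (splitAt⁻¹-↑ʳ eq)
  ... | inj₁ j with splitAt m j in eq′
  ...   | inj₁ s = trans (cong (join (m + n) (m * n) ∘ inj₁) (splitAt⁻¹-↑ˡ eq′)) (splitAt⁻¹-↑ˡ eq)
  ...   | inj₂ t = trans (cong (join (m + n) (m * n) ∘ inj₁) (splitAt⁻¹-↑ʳ eq′)) (splitAt⁻¹-↑ˡ eq)

  decode-encode : ∀ a → vtx (encode a) ≡ a
  decode-encode (loopX s)
    rewrite splitAt-join (m + n) (m * n) (inj₁ (join m n (inj₁ s))) | splitAt-join m n (inj₁ s) = refl
  decode-encode (loopY t)
    rewrite splitAt-join (m + n) (m * n) (inj₁ (join m n (inj₂ t))) | splitAt-join m n (inj₂ t) = refl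
  decode-encode (edge s t)
    rewrite splitAt-join (m + n) (m * n) (inj₂ (combine s t)) = cong (uncurry edge) (remQuot-combine s t)

  vtx-injective : ∀ {u w} → vtx u ≡ vtx w → u ≡ w
  vtx-injective {u} {w} eq = trans (sym (encode-decode u)) (trans (cong encode eq) (encode-decode w))

  NonCrossing : Vtx m n → Vtx m n → Set
  NonCrossing a b = ∀ {s₁ t₁ s₂ t₂} → a ≡ edge s₁ t₁ → b ≡ edge s₂ t₂ → s₁ < s₂ → t₁ < t₂

  Compatible : Vtx m n → Vtx m n → Set
  Compatible a b = ¬ ShareLetter a b × NonCrossing a b × NonCrossing b a

  shareLetter-sym : ∀ {a b : Vtx m n} → ShareLetter a b → ShareLetter b a
  shareLetter-sym (inj₁ (s , a∋s , b∋s)) = inj₁ (s , b∋s , a∋s)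
  shareLetter-sym (inj₂ (t , a∋t , b∋t)) = inj₂ (t , b∋t , a∋t)

  compatible-sym : ∀ {a b : Vtx m n} → Compatible a b → Compatible b a
  compatible-sym (¬share , ab , ba) = ¬share ∘ shareLetter-sym , ba , ab

  hasX? : ∀ s (a : Vtx m n) → Dec (HasX s a)
  hasX? s (loopX s′)  = s ≟ s′
  hasX? s (loopY _)   = no λ ()
  hasX? s (edge s′ _) = s ≟ s′

  hasY? : ∀ t (a : Vtx m n) → Dec (HasY t a)
  hasY? t (loopX _)   = no λ ()
  hasY? t (loopY t′)  = t ≟ t′
  hasY? t (edge _ t′) = t ≟ t′

  shareLetter? : ∀ a b → Dec (ShareLetter a b)
  shareLetter? a b = any? (λ s → hasX? s a ×-dec hasX? s b) ⊎-dec any? (λ t → hasY? t a ×-dec hasY? t b)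

  nonCrossing? : ∀ a b → Dec (NonCrossing a b)
  nonCrossing? (loopX _)  b          = yes λ ()
  nonCrossing? (loopY _)  b          = yes λ ()
  nonCrossing? (edge _ _) (loopX _)  = yes λ _ ()
  nonCrossing? (edge _ _) (loopY _)  = yes λ _ ()
  nonCrossing? (edge s t) (edge s′ t′) with (s <? s′) →-dec (t <? t′)
  ... | yes s<s′⇒t<t′ = yes λ { refl refl → s<s′⇒t<t′ }
  ... | no ¬s<s′⇒t<t′ = no λ nc → ¬s<s′⇒t<t′ (nc refl refl)

  compatible? : ∀ a b → Dec (Compatible a b)
  compatible? a b = ¬? (shareLetter? a b) ×-dec nonCrossing? a b ×-dec nonCrossing? b a

  open FlagComplex {_~_ = λ u w → Compatible (vtx u) (vtx w)}
                   compatible-sym (λ u w → compatible? (vtx u) (vtx w))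
    public

  Γ≐Flag⊤ : Γ m n ≐ Flag ⊤
  Γ≐Flag⊤ = to , from
    where
    to : ∀ {σ} → Γ m n σ → Flag ⊤ σ
    to (disjointLetters , noncrossing) =
      (λ _ → ∈⊤) ,
      λ {u} {w} u∈ w∈ u≢w →
        disjointLetters u w u∈ w∈ u≢w , noncrossing u w u∈ w∈ _ _ _ _ , noncrossing w u w∈ u∈ _ _ _ _
    from : ∀ {σ} → Flag ⊤ σ → Γ m n σ
    from {σ} (_ , σ-clique) = (λ u w u∈ w∈ u≢w → proj₁ (σ-clique u∈ w∈ u≢w)) , noncrossing
      where
      noncrossing : ∀ u w → u ∈ σ → w ∈ σ → ∀ s₁ t₁ s₂ t₂ →
        vtx u ≡ edge s₁ t₁ → vtx w ≡ edge s₂ t₂ → s₁ < s₂ → t₁ < t₂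
      noncrossing u w u∈ w∈ s₁ t₁ s₂ t₂ u≡ w≡ s₁<s₂ with u ≟ w
      ... | no u≢w = proj₁ (proj₂ (σ-clique u∈ w∈ u≢w)) u≡ w≡ s₁<s₂
      ... | yes refl with trans (sym u≡) w≡
      ...   | refl = ⊥-elim (<-irrefl refl s₁<s₂)

  IsEdge : Vtx m n → Set
  IsEdge a = ∃₂ λ s t → a ≡ edge s t

  isEdge? : ∀ a → Dec (IsEdge a)
  isEdge? (loopX _)  = no λ ()
  isEdge? (loopY _)  = no λ ()
  isEdge? (edge s t) = yes (s , t , refl)

  loop-hasX : ∀ {a s} → ¬ IsEdge a → HasX s a → a ≡ loopX s
  loop-hasX {loopX _}  _      refl = refl
  loop-hasX {edge s t} ¬edge  _    = ⊥-elim (¬edge (s , t , refl))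

  loop-hasY : ∀ {a t} → ¬ IsEdge a → HasY t a → a ≡ loopY t
  loop-hasY {loopY _}  _      refl = refl
  loop-hasY {edge s t} ¬edge  _    = ⊥-elim (¬edge (s , t , refl))

  loops-shareLetter⇒≡ : ∀ {a b} → ¬ IsEdge a → ¬ IsEdge b → ShareLetter a b → a ≡ b
  loops-shareLetter⇒≡ ¬a ¬b (inj₁ (_ , a∋s , b∋s)) = trans (loop-hasX ¬a a∋s) (sym (loop-hasX ¬b b∋s))
  loops-shareLetter⇒≡ ¬a ¬b (inj₂ (_ , a∋t , b∋t)) = trans (loop-hasY ¬a a∋t) (sym (loop-hasY ¬b b∋t))

  loops-isClique : ∀ {W} → (∀ {u} → u ∈ W → ¬ IsEdge (vtx u)) → IsClique W
  loops-isClique loops u∈ w∈ u≢w =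
    u≢w ∘ vtx-injective ∘ loops-shareLetter⇒≡ (loops u∈) (loops w∈) ,
    (λ u≡ _ → ⊥-elim (loops u∈ (_ , _ , u≡))) ,
    (λ w≡ _ → ⊥-elim (loops w∈ (_ , _ , w≡)))

  compatible-edge⇒loopXˡ : ∀ {s t b} → Compatible (edge s t) b → Compatible (loopX s) b
  compatible-edge⇒loopXˡ (¬share , _) =
    (λ { (inj₁ x-shared) → ¬share (inj₁ x-shared) ; (inj₂ (_ , () , _)) }) , (λ ()) , λ _ ()

  compatible-edge⇒loopXʳ : ∀ {a s t} → Compatible a (edge s t) → Compatible a (loopX s)
  compatible-edge⇒loopXʳ = compatible-sym ∘ compatible-edge⇒loopXˡ ∘ compatible-sym

  xLoop : Fin m → Fin (NV m n)
  xLoop s = encode (loopX s)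

  decode-xLoop : ∀ {s} → vtx (xLoop s) ≡ loopX s
  decode-xLoop {s} = decode-encode (loopX s)

  xLoop≢edge : ∀ {s v s′ t} → vtx v ≡ edge s′ t → xLoop s ≢ v
  xLoop≢edge v≡edge refl with trans (sym decode-xLoop) v≡edge
  ... | ()

  XLoopClosed : Subset (NV m n) → Set
  XLoopClosed W = ∀ {u s t} → u ∈ W → vtx u ≡ edge s t → xLoop s ∈ W

  XLoopClosed-remove-edge : ∀ {W v s t} → XLoopClosed W → vtx v ≡ edge s t → XLoopClosed (W - v)
  XLoopClosed-remove-edge {W} closed v≡edge u∈ u≡edge =
    x∈p∧x≢y⇒x∈p-y (closed (p─q⊆p W _ u∈) u≡edge) (xLoop≢edge v≡edge)

  XLoopClosed-neighbours-edge : ∀ {W v s t} → XLoopClosed W → vtx v ≡ edge s t →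
                                XLoopClosed (neighbours W v)
  XLoopClosed-neighbours-edge {v = v} closed v≡edge u∈ u≡edge =
    let u∈W , _ , v~u = ∈-neighbours⁻ u∈ in
    ∈-neighbours⁺ (closed u∈W u≡edge , xLoop≢edge v≡edge ,
      subst (Compatible (vtx v)) (sym decode-xLoop)
        (compatible-edge⇒loopXʳ (subst (Compatible (vtx v)) u≡edge v~u)))

  xLoop-dominates-edge : ∀ {W v s t} → XLoopClosed W → v ∈ W → vtx v ≡ edge s t →
                         Dominates W (xLoop s) v
  xLoop-dominates-edge {s = s} closed v∈W v≡edge = record
    { v∈W      = v∈W
    ; w∈W      = closed v∈W v≡edge
    ; w≢v      = xLoop≢edge v≡edge
    ; v≁w      = λ (¬share , _) →
                   ¬share (subst₂ ShareLetter (sym v≡edge) (sym decode-xLoop) (inj₁ (s , refl , refl)))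
    ; adjacent = λ u∈ → subst (λ a → Compatible a _) (sym decode-xLoop)
                          (compatible-edge⇒loopXˡ
                            (subst (λ a → Compatible a _) v≡edge (neighbour-adjacent u∈)))
    }

  cliqueOrShedding : ∀ {W} → XLoopClosed W → CliqueOrShedding XLoopClosed W
  cliqueOrShedding {W} closed with any? (λ u → (u ∈? W) ×-dec isEdge? (vtx u))
  ... | no noEdge = inj₁ (loops-isClique λ u∈ isEdge → noEdge (_ , u∈ , isEdge))
  ... | yes (v , v∈W , s , t , v≡edge) =
    inj₂ (xLoop s , v , xLoop-dominates-edge closed v∈W v≡edge ,
          XLoopClosed-remove-edge closed v≡edge , XLoopClosed-neighbours-edge closed v≡edge)

theorem3p10 : (m n : ℕ) → VertexDecomposable (Γ m n)
theorem3p10 m n =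
  VertexDecomposable-resp-≐ (≐-sym Γ≐Flag⊤) (flag-vertexDecomposable cliqueOrShedding λ _ _ → ∈⊤)
  where open NoncrossingMatching m n
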